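{- The Fibonacci morphism $\varphi$ is interference-free on $\mathcal{L}_F=\{F_i: i\ge4,\ i\text{ even}\}$.
   Context: $\varphi(\mathtt{a})=\mathtt{ab}$, $\varphi(\mathtt{b})=\mathtt{a}$ (an injective morphism), and $F_i=\varphi^{i-1}(\mathtt{b})$. Images are $\varphi(\mathtt{a}),\varphi(\mathtt{b})$. A word admits an image factorization if it is a concatenation of zero or more images. A word $w$ admits an interfered image factorization if $w=xyz$ with $x$ a proper (possibly empty) suffix of some image, $y$ admitting an image factorization, $z$ a proper (possibly empty) prefix of some image, and $xz\neq\varepsilon$. A word is an inner image factor if it is a proper factor of some image that is neither a prefix nor a suffix of it. An injective morphism is interference-free on $\mathcal{L}$ if for every non-empty $u\in\mathcal{L}$, the image of $u$ admits no interfered image factorization and is not an inner image factor. -}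

module Defs where

open import Data.Nat using (ℕ; zero; suc; _≥_)
open import Data.List using (List; []; _∷_; _++_; concatMap)
open import Data.Product using (Σ; ∃; _×_; _,_)
open import Data.Sum using (_⊎_)
open import Relation.Binary.PropositionalEquality using (_≡_; _≢_)
open import Relation.Nullary using (¬_)

data Letter : Set where
  a b : Letter

Word : Set
Word = List Letter

φ : Letter → Word
φ a = a ∷ b ∷ []
φ b = a ∷ []

φ* : Word → Word
φ* = concatMap φ

φ*^ : ℕ → Word → Word
φ*^ zero    w = w
φ*^ (suc n) w = φ* (φ*^ n w)

-- Fibonacci words F_i = φ^{i-1}(b), for i ≥ 1 (F 0 is unused; set to b)
F : ℕ → Word
F zero    = b ∷ []
F (suc n) = φ*^ n (b ∷ [])

IsImage : Word → Set
IsImage w = ∃ λ (c : Letter) → w ≡ φ c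

data ImageFactorization : Word → Set where
  nil  : ImageFactorization []
  cons : (c : Letter) {w : Word} → ImageFactorization w → ImageFactorization (φ c ++ w)

ProperSuffixOfImage : Word → Set
ProperSuffixOfImage x = ∃ λ (c : Letter) → ∃ λ (p : Word) → p ≢ [] × p ++ x ≡ φ c

ProperPrefixOfImage : Word → Set
ProperPrefixOfImage z = ∃ λ (c : Letter) → ∃ λ (s : Word) → s ≢ [] × z ++ s ≡ φ c

InterferedImageFactorization : Word → Set
InterferedImageFactorization w =
  ∃ λ (x : Word) → ∃ λ (y : Word) → ∃ λ (z : Word) →
    (w ≡ x ++ y ++ z) × ProperSuffixOfImage x × ImageFactorization y
    × ProperPrefixOfImage z × (x ++ z ≢ [])

IsFactor : Word → Word → Set
IsFactor u v = ∃ λ (p : Word) → ∃ λ (s : Word) → p ++ u ++ s ≡ v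

IsPrefix : Word → Word → Set
IsPrefix u v = ∃ λ (s : Word) → u ++ s ≡ v

IsSuffix : Word → Word → Set
IsSuffix u v = ∃ λ (p : Word) → p ++ u ≡ v

InnerImageFactor : Word → Set
InnerImageFactor w = ∃ λ (c : Letter) →
  IsFactor w (φ c) × w ≢ φ c × ¬ IsPrefix w (φ c) × ¬ IsSuffix w (φ c)

data InLF : Word → Set where
  inLF : (k : ℕ) → k ≥ 2 → InLF (F (k Data.Nat.* 2))

InterferenceFree : (Word → Set) → Set
InterferenceFree L = (u : Word) → L u → u ≢ [] →
  ¬ InterferedImageFactorization (φ* u) × ¬ InnerImageFactor (φ* u)

-- Both images ab and a have length at most two, so no word is an inner image
-- factor, a proper suffix of an image is ε or b, and a proper prefix is ε or a.
-- An interfered factorization of a word beginning with a and ending with b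
-- would therefore need x = z = ε. The image of any non-empty word begins with
-- a, and φ² preserves the last letter, so φ(F_2k) = φ^2k(b) ends with b.
module Submission where

open import Defs
open import Data.Nat using (zero; suc; _*_)
open import Data.List using ([]; _∷_; _++_; _∷ʳ_)
open import Data.List.Properties using (concatMap-++; ∷ʳ-++; ∷ʳ-injectiveʳ; ++-identityʳ)
open import Data.Product using (∃; _,_)
open import Data.Sum using (_⊎_; inj₁; inj₂)
open import Data.Empty using (⊥-elim)
open import Relation.Binary.PropositionalEquality using (_≡_; _≢_; refl; sym; trans; cong)
open import Relation.Nullary using (¬_)

StartsWith : Letter → Word → Set
StartsWith c w = ∃ λ t → w ≡ c ∷ t

EndsWith : Letter → Word → Set
EndsWith c w = ∃ λ q → w ≡ q ∷ʳ c

swap : Letter → Letter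
swap a = b
swap b = a

φ*-startsWith-a : ∀ u → u ≢ [] → StartsWith a (φ* u)
φ*-startsWith-a []      u≢[] = ⊥-elim (u≢[] refl)
φ*-startsWith-a (a ∷ u) _    = b ∷ φ* u , refl
φ*-startsWith-a (b ∷ u) _    = φ* u , refl

φ*-endsWith-swap : ∀ {c w} → EndsWith c w → EndsWith (swap c) (φ* w)
φ*-endsWith-swap {a} (q , refl) =
  φ* q ∷ʳ a , trans (concatMap-++ φ q (a ∷ [])) (sym (∷ʳ-++ (φ* q) a (b ∷ [])))
φ*-endsWith-swap {b} (q , refl) = φ* q , concatMap-++ φ q (b ∷ [])

φ*^-even-endsWith : ∀ {c w} k → EndsWith c w → EndsWith c (φ*^ (k * 2) w)
φ*^-even-endsWith zero e = e
φ*^-even-endsWith {a} (suc k) e = φ*-endsWith-swap (φ*-endsWith-swap (φ*^-even-endsWith k e))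
φ*^-even-endsWith {b} (suc k) e = φ*-endsWith-swap (φ*-endsWith-swap (φ*^-even-endsWith k e))

properSuffixOfImage-cases : ∀ {x} → ProperSuffixOfImage x → x ≡ [] ⊎ x ≡ b ∷ []
properSuffixOfImage-cases (a , []          , p≢[] , _)    = ⊥-elim (p≢[] refl)
properSuffixOfImage-cases (a , a ∷ []      , _    , refl) = inj₂ refl
properSuffixOfImage-cases (a , a ∷ b ∷ []  , _    , refl) = inj₁ refl
properSuffixOfImage-cases (b , []          , p≢[] , _)    = ⊥-elim (p≢[] refl)
properSuffixOfImage-cases (b , a ∷ []      , _    , refl) = inj₁ refl

properPrefixOfImage-cases : ∀ {z} → ProperPrefixOfImage z → z ≡ [] ⊎ z ≡ a ∷ []
properPrefixOfImage-cases {[]}             _                  = inj₁ refl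
properPrefixOfImage-cases {a ∷ []}         _                  = inj₂ refl
properPrefixOfImage-cases {a ∷ b ∷ []}     (a , [] , s≢[] , _) = ⊥-elim (s≢[] refl)
properPrefixOfImage-cases {a ∷ b ∷ []}     (b , _  , _    , ())
properPrefixOfImage-cases {a ∷ a ∷ _}      (a , _  , _    , ())
properPrefixOfImage-cases {a ∷ a ∷ _}      (b , _  , _    , ())
properPrefixOfImage-cases {a ∷ b ∷ _ ∷ _}  (a , _  , _    , ())
properPrefixOfImage-cases {a ∷ b ∷ _ ∷ _}  (b , _  , _    , ())
properPrefixOfImage-cases {b ∷ _}          (a , _  , _    , ())
properPrefixOfImage-cases {b ∷ _}          (b , _  , _    , ())

¬innerImageFactor : ∀ w → ¬ InnerImageFactor w
¬innerImageFactor []      (c , _ , _ , ¬prefix , _) = ¬prefix (φ c , refl)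
¬innerImageFactor (x ∷ w) (c , ([] , s , eq) , _ , ¬prefix , _) = ¬prefix (s , eq)
¬innerImageFactor (x ∷ w) (c , (p , [] , eq) , _ , _ , ¬suffix) =
  ¬suffix (p , trans (cong (p ++_) (sym (++-identityʳ (x ∷ w)))) eq)
¬innerImageFactor (_ ∷ [])    (a , (_ ∷ []        , _ ∷ _ , ()) , _)
¬innerImageFactor (_ ∷ _ ∷ _) (a , (_ ∷ []        , _ ∷ _ , ()) , _)
¬innerImageFactor (_ ∷ _)     (a , (_ ∷ _ ∷ []    , _ ∷ _ , ()) , _)
¬innerImageFactor (_ ∷ _)     (a , (_ ∷ _ ∷ _ ∷ _ , _ ∷ _ , ()) , _)
¬innerImageFactor (_ ∷ _)     (b , (_ ∷ []        , _ ∷ _ , ()) , _)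
¬innerImageFactor (_ ∷ _)     (b , (_ ∷ _ ∷ _     , _ ∷ _ , ()) , _)

a≢b : a ≢ b
a≢b ()

¬interferedImageFactorization : ∀ {w} → StartsWith a w → EndsWith b w →
                                ¬ InterferedImageFactorization w
¬interferedImageFactorization (t , refl) (q , w≡qb) (x , y , z , w≡xyz , sx , _ , pz , xz≢[])
  with properSuffixOfImage-cases sx | properPrefixOfImage-cases pz | w≡xyz
... | inj₂ refl | _         | ()
... | inj₁ refl | inj₁ refl | _    = xz≢[] refl
... | inj₁ refl | inj₂ refl | w≡ya = a≢b (∷ʳ-injectiveʳ y q (trans (sym w≡ya) w≡qb))

-- φ* (F (2k + 2)) reduces to φ*^ (2k + 2) (b ∷ []); only k ≥ 1 of the hypothesis k ≥ 2 is needed.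
corollary13 : InterferenceFree InLF
corollary13 _ (inLF zero ())
corollary13 _ (inLF (suc k) _) u≢[] =
    ¬interferedImageFactorization (φ*-startsWith-a _ u≢[])
                                  (φ*^-even-endsWith (suc k) ([] , refl))
  , ¬innerImageFactor _
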